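{- Let $k,w$ be positive integers and let $A$ be the adjacency matrix of a regular tournament of order $2k+1$. Let $B$ be the $2w\times 2w$ block matrix each of whose block rows is $(A, A^T, A, A^T,\dots,A,A^T)$, and let $C$ be the $2w\times 2w$ block matrix whose block row $i$ consists entirely of blocks $A$ if $i$ is odd and entirely of blocks $A^T$ if $i$ is even. If there exists a permutation matrix $P$ such that $PA=A^T=AP$, then $B\cong C$, i.e. there is a permutation matrix $Q$ with $QBQ^{ -1}=C$.
   Context: A tournament is a directed graph without loops in which for every pair of distinct vertices $x,y$ exactly one of the arcs $x\to y$, $y\to x$ is present; its $0/1$ adjacency matrix $A$ satisfies $A+A^T=J-I$. It is regular if all out-degrees are equal. -}

module Defs where

open import Data.Nat using (ℕ; zero; suc; _+_; _*_)
open import Data.Nat.Properties using (_≟_)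
open import Data.Fin using (Fin; zero; suc; toℕ; remQuot)
open import Data.Fin.Permutation using (Permutation′; _⟨$⟩ʳ_)
open import Data.Product using (_×_; _,_; proj₁; proj₂)
open import Data.Bool using (Bool; true; false; if_then_else_)
open import Relation.Nullary using (does)
open import Relation.Binary.PropositionalEquality using (_≡_)
import Data.Fin as F

Matrix : ℕ → Set
Matrix n = Fin n → Fin n → ℕ

Σ : ∀ {n} → (Fin n → ℕ) → ℕ
Σ {zero} f = 0
Σ {suc n} f = f zero + Σ (λ i → f (suc i))

_⊗_ : ∀ {n} → Matrix n → Matrix n → Matrix n
(M ⊗ N) i j = Σ (λ l → M i l * N l j)

transpose : ∀ {n} → Matrix n → Matrix n
transpose M i j = M j i

J-I : ∀ {n} → Matrix n
J-I i j = if does (i F.≟ j) then 0 else 1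

_≈M_ : ∀ {n} → Matrix n → Matrix n → Set
M ≈M N = ∀ i j → M i j ≡ N i j

IsTournament : ∀ {n} → Matrix n → Set
IsTournament A = (∀ i j → (A i j ≡ 0) Data.Sum.⊎ (A i j ≡ 1))
                 × (∀ i j → A i j + A j i ≡ J-I i j)
  where import Data.Sum

outDeg : ∀ {n} → Matrix n → Fin n → ℕ
outDeg A i = Σ (λ j → A i j)

IsRegular : ∀ {n} → Matrix n → Set
IsRegular A = ∀ i j → outDeg A i ≡ outDeg A j

permMatrix : ∀ {n} → Permutation′ n → Matrix n
permMatrix σ i j = if does ((σ ⟨$⟩ʳ i) F.≟ j) then 1 else 0

IsPermutationMatrix : ∀ {n} → Matrix n → Set
IsPermutationMatrix {n} P = Data.Product.Σ (Permutation′ n) (λ σ → P ≈M permMatrix σ)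
  where import Data.Product

even? : ∀ {m} → Fin m → Bool
even? i = does (Data.Nat.DivMod._%_ (toℕ i) 2 ≟ 0)
  where import Data.Nat.DivMod

-- a block matrix of size (m·n) with m×m blocks of size n, given by blk r c
blockMatrix : ∀ m {n} → (Fin m → Fin m → Matrix n) → Matrix (m * n)
blockMatrix m {n} blk i j with remQuot {m} n i | remQuot {m} n j
... | r , a | c , b = blk r c a b

-- B: every block row is (A, Aᵀ, A, Aᵀ, …); block column c (0-based) is A iff c even
Bmat : ∀ w {n} → Matrix n → Matrix ((2 * w) * n)
Bmat w A = blockMatrix (2 * w) (λ r c → if even? c then A else transpose A)

-- C: block row i (1-based) is all A if i odd, all Aᵀ if i even (0-based r even ↔ 1-based odd)
Cmat : ∀ w {n} → Matrix n → Matrix ((2 * w) * n)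
Cmat w A = blockMatrix (2 * w) (λ r c → if even? r then A else transpose A)

-- Let Q be block diagonal with blocks I in the even block rows and P in the odd
-- ones. Conjugating B by Q turns block (r, c) into P_r B_c P_cᵀ, where B_c is A
-- or Aᵀ according to the parity of c. Writing P as the permutation σ, the
-- hypothesis PA = Aᵀ says A (σ x) y = A y x, so permuting the rows of A by σ
-- transposes it; a short case analysis on the parities of r and c then shows
-- P_r B_c P_cᵀ is A for r even and Aᵀ for r odd, which is C.
module Submission where

open import Defs
open import Data.Nat using (ℕ; zero; suc; _+_; _*_; _≤_)
open import Data.Nat.Properties using (+-identityʳ; *-identityˡ; *-comm)
open import Data.Product using (Σ-syntax; _×_; _,_; proj₁; proj₂)
open import Data.Fin using (Fin; zero; suc; remQuot; combine)
open import Data.Fin.Properties using (remQuot-combine; combine-remQuot)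
open import Data.Fin.Permutation
  using (Permutation′; _⟨$⟩ʳ_; _⟨$⟩ˡ_; permutation; inverseˡ; inverseʳ)
import Data.Fin.Permutation as Permutation
open import Data.Bool using (true; false; if_then_else_)
open import Relation.Nullary using (does)
open import Relation.Binary.PropositionalEquality
import Data.Fin as F

Σ-cong : ∀ {n} {f g : Fin n → ℕ} → (∀ i → f i ≡ g i) → Σ f ≡ Σ g
Σ-cong {zero}  f≗g = refl
Σ-cong {suc n} f≗g = cong₂ _+_ (f≗g zero) (Σ-cong (λ i → f≗g (suc i)))

Σ-zero : ∀ n → Σ {n} (λ _ → 0) ≡ 0
Σ-zero zero    = refl
Σ-zero (suc n) = Σ-zero n

Σ-select : ∀ {n} (x : Fin n) (f : Fin n → ℕ) →
           Σ (λ l → (if does (x F.≟ l) then 1 else 0) * f l) ≡ f x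
Σ-select {suc n} zero f = begin
  1 * f zero + Σ {n} (λ _ → 0) ≡⟨ cong (1 * f zero +_) (Σ-zero n) ⟩
  1 * f zero + 0               ≡⟨ +-identityʳ _ ⟩
  1 * f zero                   ≡⟨ *-identityˡ _ ⟩
  f zero                       ∎
  where open ≡-Reasoning
Σ-select {suc n} (suc x) f = Σ-select x (λ l → f (suc l))

permMatrix-⊗ˡ : ∀ {n} (σ : Permutation′ n) (M : Matrix n) i j →
                (permMatrix σ ⊗ M) i j ≡ M (σ ⟨$⟩ʳ i) j
permMatrix-⊗ˡ σ M i j = Σ-select (σ ⟨$⟩ʳ i) (λ l → M l j)

⊗-transpose-permMatrix : ∀ {n} (σ : Permutation′ n) (M : Matrix n) i j →
                         (M ⊗ transpose (permMatrix σ)) i j ≡ M i (σ ⟨$⟩ʳ j)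
⊗-transpose-permMatrix σ M i j =
  trans (Σ-cong (λ l → *-comm (M i l) (permMatrix σ j l)))
        (Σ-select (σ ⟨$⟩ʳ j) (M i))

permMatrix-conjugate : ∀ {n} (σ : Permutation′ n) (M : Matrix n) i j →
  ((permMatrix σ ⊗ M) ⊗ transpose (permMatrix σ)) i j ≡ M (σ ⟨$⟩ʳ i) (σ ⟨$⟩ʳ j)
permMatrix-conjugate σ M i j =
  trans (⊗-transpose-permMatrix σ (permMatrix σ ⊗ M) i j)
        (permMatrix-⊗ˡ σ M i (σ ⟨$⟩ʳ j))

module _ (m : ℕ) {n : ℕ} (blk : Fin m → Fin m → Matrix n) where

  blockMatrix-remQuot : ∀ i j →
    blockMatrix m blk i j ≡ blk (proj₁ (remQuot {m} n i)) (proj₁ (remQuot {m} n j))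
                                (proj₂ (remQuot {m} n i)) (proj₂ (remQuot {m} n j))
  blockMatrix-remQuot i j with remQuot {m} n i | remQuot {m} n j
  ... | r , a | c , b = refl

  blockMatrix-combine : ∀ r c a b → blockMatrix m blk (combine r a) (combine c b) ≡ blk r c a b
  blockMatrix-combine r c a b =
    trans (blockMatrix-remQuot (combine r a) (combine c b))
          (cong₂ (λ (p q : Fin m × Fin n) → blk (proj₁ p) (proj₁ q) (proj₂ p) (proj₂ q))
                 (remQuot-combine r a) (remQuot-combine c b))

module _ {m n : ℕ} (τ : Fin m → Permutation′ n) where

  private
    blockwise : (Permutation′ n → Fin n → Fin n) → Fin (m * n) → Fin (m * n)
    blockwise apply i = combine r (apply (τ r) a)
      where r = proj₁ (remQuot {m} n i); a = proj₂ (remQuot {m} n i)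

    blockwise-inverse : (f g : Permutation′ n → Fin n → Fin n) →
                        (∀ π {a} → f π (g π a) ≡ a) → ∀ i → blockwise f (blockwise g i) ≡ i
    blockwise-inverse f g f∘g≡id i = begin
      blockwise f (blockwise g i)     ≡⟨ cong (λ (p : Fin m × Fin n) → combine (proj₁ p) (f (τ (proj₁ p)) (proj₂ p)))
                                              (remQuot-combine {m} {n} r (g (τ r) a)) ⟩
      combine r (f (τ r) (g (τ r) a)) ≡⟨ cong (combine r) (f∘g≡id (τ r)) ⟩
      combine r a                     ≡⟨ combine-remQuot {m} n i ⟩
      i                               ∎
      where open ≡-Reasoning
            r = proj₁ (remQuot {m} n i); a = proj₂ (remQuot {m} n i)

  blockDiagonal : Permutation′ (m * n)
  blockDiagonal = permutation (blockwise _⟨$⟩ʳ_) (blockwise _⟨$⟩ˡ_)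
                              (blockwise-inverse _⟨$⟩ʳ_ _⟨$⟩ˡ_ inverseʳ)
                              (blockwise-inverse _⟨$⟩ˡ_ _⟨$⟩ʳ_ inverseˡ)

  blockMatrix-conjugate-blockDiagonal : (blk blk′ : Fin m → Fin m → Matrix n) →
    (∀ r c a b → blk r c (τ r ⟨$⟩ʳ a) (τ c ⟨$⟩ʳ b) ≡ blk′ r c a b) →
    ((permMatrix blockDiagonal ⊗ blockMatrix m blk) ⊗ transpose (permMatrix blockDiagonal))
      ≈M blockMatrix m blk′
  blockMatrix-conjugate-blockDiagonal blk blk′ blk≈blk′ i j = begin
    ((permMatrix blockDiagonal ⊗ blockMatrix m blk) ⊗ transpose (permMatrix blockDiagonal)) i j
      ≡⟨ permMatrix-conjugate blockDiagonal (blockMatrix m blk) i j ⟩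
    blockMatrix m blk (combine r (τ r ⟨$⟩ʳ a)) (combine c (τ c ⟨$⟩ʳ b))
      ≡⟨ blockMatrix-combine m blk r c _ _ ⟩
    blk r c (τ r ⟨$⟩ʳ a) (τ c ⟨$⟩ʳ b)
      ≡⟨ blk≈blk′ r c a b ⟩
    blk′ r c a b
      ≡⟨ blockMatrix-remQuot m blk′ i j ⟨
    blockMatrix m blk′ i j ∎
    where open ≡-Reasoning
          r = proj₁ (remQuot {m} n i); a = proj₂ (remQuot {m} n i)
          c = proj₁ (remQuot {m} n j); b = proj₂ (remQuot {m} n j)

permMatrix-⊗≈transpose⇒ : ∀ {n} (σ : Permutation′ n) (A : Matrix n) →
  (permMatrix σ ⊗ A) ≈M transpose A → ∀ x y → A (σ ⟨$⟩ʳ x) y ≡ A y x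
permMatrix-⊗≈transpose⇒ σ A σA≈Aᵀ x y = trans (sym (permMatrix-⊗ˡ σ A x y)) (σA≈Aᵀ x y)

lemma14 : (k w : ℕ) → 1 ≤ k → 1 ≤ w → (A : Matrix (2 * k + 1))
    → IsTournament A → IsRegular A
    → Σ[ P ∈ Matrix (2 * k + 1) ] (IsPermutationMatrix P × ((P ⊗ A) ≈M transpose A) × ((A ⊗ P) ≈M transpose A))
    → Σ[ Q ∈ Matrix ((2 * w) * (2 * k + 1)) ]
        (IsPermutationMatrix Q × (((Q ⊗ Bmat w A) ⊗ transpose Q) ≈M Cmat w A))
lemma14 k w _ _ A _ _ (P , (σ , P≈σ) , PA≈Aᵀ , _) =
  permMatrix (blockDiagonal τ) , (blockDiagonal τ , λ _ _ → refl) ,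
  blockMatrix-conjugate-blockDiagonal τ Bblock Cblock blocks
  where
  σ-transposes : ∀ x y → A (σ ⟨$⟩ʳ x) y ≡ A y x
  σ-transposes = permMatrix-⊗≈transpose⇒ σ A
    (λ x y → trans (sym (Σ-cong (λ l → cong (_* A l y) (P≈σ x l)))) (PA≈Aᵀ x y))

  τ : Fin (2 * w) → Permutation′ (2 * k + 1)
  τ r = if even? r then Permutation.id else σ

  Bblock Cblock : Fin (2 * w) → Fin (2 * w) → Matrix (2 * k + 1)
  Bblock r c = if even? c then A else transpose A
  Cblock r c = if even? r then A else transpose A

  blocks : ∀ r c a b → Bblock r c (τ r ⟨$⟩ʳ a) (τ c ⟨$⟩ʳ b) ≡ Cblock r c a b
  blocks r c a b with even? r | even? c
  ... | true  | true  = refl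
  ... | false | true  = σ-transposes a b
  ... | true  | false = σ-transposes b a
  ... | false | false = trans (σ-transposes b (σ ⟨$⟩ʳ a)) (σ-transposes a b)
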